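{- For every continuation $K$ and all terms $M, M'$, if $M\to_{a\cup\beta}M'$ then $\underline{K}[M]\to_{a\cup\beta}\underline{K}[M']$.
   Context: Syntax. Fix a ring of scalars; $\alpha,\beta$ range over it. Terms: $M,N,L ::= V \mid MN \mid \alpha.M \mid M+N$; values $V,W ::= B \mid 0 \mid \alpha.V \mid V+W$; base values $B ::= x \mid \lambda x.M$. Terms are taken up to $\alpha$-conversion, $M[x:=N]$ is capture-avoiding substitution. Rewrite rules. $(\beta_n)$: $(\lambda x.M)N \to M[x:=N]$. $(A)$: $(M+N)L \to ML+NL$; $(\alpha.M)N \to \alpha.(MN)$; $(0)M \to 0$. $(L)$: $M+(N+L)\to(M+N)+L$; $(M+N)+L\to M+(N+L)$; $M+N\to N+M$; $\alpha.M+\beta.M\to(\alpha+\beta).M$; $\alpha.M+M\to(\alpha+1).M$; $M+M\to(1+1).M$; $\alpha.(\beta.M)\to(\alpha\beta).M$; $\alpha.(M+N)\to\alpha.M+\alpha.N$; $1.M\to M$; $0.M\to 0$; $\alpha.0\to 0$; $0+M\to M$. $(\xi)$: if $M\to M'$ then $MN\to M'N$, $M+N\to M'+N$, $N+M\to N+M'$, $\alpha.M\to\alpha.M'$. A union of rules denotes the generated relation, context rules applying to the relation being defined: $\to_{\beta_n} ::= \beta_n\cup\xi$; $\to_a ::= A\cup L\cup\xi$; $\to_{a\cup\beta} ::= \to_a\cup\to_{\beta_n}$. CPS grammar. Base computations $C ::= KB \mid BSK \mid TK$; computation combinations $D ::= C \mid 0 \mid \alpha.D \mid D_1+D_2$;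 base suspensions $S ::= x \mid \lambda k.C$; suspension combinations $T ::= S \mid 0 \mid \alpha.T \mid T_1+T_2$; continuations $K ::= k \mid \lambda b.bSK$; CPS-values $B ::= \lambda x.S$. Here $x$ ranges over ordinary variables, $k,b$ are reserved variables; $k$ occurs only as the continuation $k$ and as the binder in $\lambda k.C$; $b$ occurs only where displayed. Inverse translation: $\overline{KB}=\underline{K}[\phi(B)]$; $\overline{BSK}=\underline{K}[\phi(B)\sigma(S)]$; $\overline{TK}=\underline{K}[\sigma(T)]$; $\overline{0}=0$; $\overline{\alpha.D}=\alpha.\overline{D}$; $\overline{D_1+D_2}=\overline{D_1}+\overline{D_2}$; $\sigma(x)=x$; $\sigma(\lambda k.C)=\overline{C}$; $\sigma(0)=0$; $\sigma(\alpha.T)=\alpha.\sigma(T)$; $\sigma(T_1+T_2)=\sigma(T_1)+\sigma(T_2)$; $\phi(\lambda x.S)=\lambda x.\sigma(S)$; for a term $M$: $\underline{k}[M]=M$; $\underline{\lambda b.bSK}[M]=\underline{K}[M\,\sigma(S)]$. -}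

module Defs where

open import Level using (Level; _⊔_)
open import Algebra.Bundles using (Ring)
open import Data.Nat using (ℕ; zero; suc)
open import Data.Sum using (_⊎_)

module Lang {c ℓ : Level} (R : Ring c ℓ) where
  open Ring R using (Carrier; 0#; 1#) renaming (_+_ to _+ᵣ_; _*_ to _*ᵣ_)

  infixl 7 _·_
  infixl 6 _⊕_

  -- Terms (de Bruijn indices, so terms are taken up to α-conversion)
  -- M ::= x | λx.M | M N | α.M | M + N | 0
  data Term : Set c where
    var : ℕ → Term
    lam : Term → Term
    app : Term → Term → Term
    _·_ : Carrier → Term → Term
    _⊕_ : Term → Term → Term
    𝟘   : Term

  ext : (ℕ → ℕ) → ℕ → ℕ
  ext ρ zero    = zero
  ext ρ (suc n) = suc (ρ n)

  rename : (ℕ → ℕ) → Term → Term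
  rename ρ (var n)   = var (ρ n)
  rename ρ (lam M)   = lam (rename (ext ρ) M)
  rename ρ (app M N) = app (rename ρ M) (rename ρ N)
  rename ρ (a · M)   = a · rename ρ M
  rename ρ (M ⊕ N)   = rename ρ M ⊕ rename ρ N
  rename ρ 𝟘         = 𝟘

  exts : (ℕ → Term) → ℕ → Term
  exts σ zero    = var zero
  exts σ (suc n) = rename suc (σ n)

  subst : (ℕ → Term) → Term → Term
  subst σ (var n)   = σ n
  subst σ (lam M)   = lam (subst (exts σ) M)
  subst σ (app M N) = app (subst σ M) (subst σ N)
  subst σ (a · M)   = a · subst σ M
  subst σ (M ⊕ N)   = subst σ M ⊕ subst σ N
  subst σ 𝟘         = 𝟘

  -- M[x:=N] where x is the variable bound by the outermost λ (index 0)
  sub0 : Term → ℕ → Term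
  sub0 N zero    = N
  sub0 N (suc n) = var n

  _[_] : Term → Term → Term
  M [ N ] = subst (sub0 N) M

  Rel : Set (Level.suc c)
  Rel = Term → Term → Set c

  data BetaN : Rel where
    βn : ∀ {M N} → BetaN (app (lam M) N) (M [ N ])

  data AL : Rel where
    A-add  : ∀ {M N L} → AL (app (M ⊕ N) L) (app M L ⊕ app N L)
    A-scal : ∀ {a M N} → AL (app (a · M) N) (a · app M N)
    A-zero : ∀ {M} → AL (app 𝟘 M) 𝟘
    L-assocl : ∀ {M N L} → AL (M ⊕ (N ⊕ L)) ((M ⊕ N) ⊕ L)
    L-assocr : ∀ {M N L} → AL ((M ⊕ N) ⊕ L) (M ⊕ (N ⊕ L))
    L-comm   : ∀ {M N} → AL (M ⊕ N) (N ⊕ M)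
    L-fact   : ∀ {a b M} → AL (a · M ⊕ b · M) ((a +ᵣ b) · M)
    L-fact1  : ∀ {a M} → AL (a · M ⊕ M) ((a +ᵣ 1#) · M)
    L-fact2  : ∀ {M} → AL (M ⊕ M) ((1# +ᵣ 1#) · M)
    L-scal   : ∀ {a b M} → AL (a · (b · M)) ((a *ᵣ b) · M)
    L-dist   : ∀ {a M N} → AL (a · (M ⊕ N)) (a · M ⊕ a · N)
    L-one    : ∀ {M} → AL (1# · M) M
    L-zeroS  : ∀ {M} → AL (0# · M) 𝟘
    L-zeroT  : ∀ {a} → AL (a · 𝟘) 𝟘
    L-zeroL  : ∀ {M} → AL (𝟘 ⊕ M) M

  data Ξ (H : Rel) : Rel where
    head : ∀ {M M'} → H M M' → Ξ H M M'
    ξ-app  : ∀ {M M' N} → Ξ H M M' → Ξ H (app M N) (app M' N)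
    ξ-addl : ∀ {M M' N} → Ξ H M M' → Ξ H (M ⊕ N) (M' ⊕ N)
    ξ-addr : ∀ {M M' N} → Ξ H M M' → Ξ H (N ⊕ M) (N ⊕ M')
    ξ-scal : ∀ {a M M'} → Ξ H M M' → Ξ H (a · M) (a · M')

  _→β_ : Rel
  _→β_ = Ξ BetaN

  _→a_ : Rel
  _→a_ = Ξ AL

  _→aβ_ : Rel
  M →aβ N = (M →a N) ⊎ (M →β N)

  -- Ordinary variables x are de Bruijn indices bound by
  -- λx.S; the reserved variables k and b are represented structurally.
  --   C ::= K B | B S K | T K
  --   S ::= x | λk.C        T ::= S | 0 | α.T | T₁+T₂
  --   K ::= k | λb.b S K    B ::= λx.S
  mutual
    data CompC : Set c where
      KB  : Cont → CVal → CompC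
      BSK : CVal → Susp → Cont → CompC
      TK  : SuspC → Cont → CompC

    data Susp : Set c where
      svar : ℕ → Susp
      λk   : CompC → Susp

    data SuspC : Set c where
      base : Susp → SuspC
      t0   : SuspC
      tsc  : Carrier → SuspC → SuspC
      tadd : SuspC → SuspC → SuspC

    data Cont : Set c where
      k    : Cont
      λb   : Susp → Cont → Cont

    data CVal : Set c where
      λx : Susp → CVal

  data CompD : Set c where
    comp : CompC → CompD
    d0   : CompD
    dsc  : Carrier → CompD → CompD
    dadd : CompD → CompD → CompD

  mutual
    ‾_ : CompC → Term
    ‾ KB K B      = ⟦ K ⟧[ φ B ]
    ‾ BSK B S K   = ⟦ K ⟧[ app (φ B) (σ S) ]
    ‾ TK T K      = ⟦ K ⟧[ σT T ]

    σ : Susp → Term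
    σ (svar x) = var x
    σ (λk C)   = ‾ C

    σT : SuspC → Term
    σT (base S)     = σ S
    σT t0           = 𝟘
    σT (tsc a T)    = a · σT T
    σT (tadd T₁ T₂) = σT T₁ ⊕ σT T₂

    φ : CVal → Term
    φ (λx S) = lam (σ S)

    ⟦_⟧[_] : Cont → Term → Term
    ⟦ k ⟧[ M ]      = M
    ⟦ λb S K ⟧[ M ] = ⟦ K ⟧[ app M (σ S) ]

  ‾D : CompD → Term
  ‾D (comp C)     = ‾ C
  ‾D d0           = 𝟘
  ‾D (dsc a D)    = a · ‾D D
  ‾D (dadd D₁ D₂) = ‾D D₁ ⊕ ‾D D₂

module Submission where

-- A continuation K denotes the evaluation context K̲[-], which by the
-- defining equations  k̲[M] = M  and  (λb.bSK)̲[M] = K̲[M σ(S)]  is an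
-- iterated left application  M ↦ (…((M σ(S₁)) σ(S₂))…) σ(Sₙ).
-- Hence the theorem splits into two independent facts:
--   * every relation that is compatible with left application is
--     preserved by K̲[-]  (induction on K), and
--   * →aβ is compatible with left application, since each of →a and →β
--     is closed under the context rule (ξ) M → M' ⟹ MN → M'N.

open import Defs
open import Level using (Level)
open import Algebra.Bundles using (Ring)
open import Data.Sum using (inj₁; inj₂)

module _ {c ℓ : Level} (R : Ring c ℓ) where
  open Lang R

  LeftAppCompatible : Rel → Set c
  LeftAppCompatible _↝_ = ∀ {M M' N} → M ↝ M' → app M N ↝ app M' N

  -- Plugging into a continuation preserves every relation compatible
  -- with left application: K̲[-] only ever applies its hole to arguments.
  plug-preserves : ∀ (_↝_ : Rel) → LeftAppCompatible _↝_ →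
    ∀ (K : Cont) {M M' : Term} → M ↝ M' → ⟦ K ⟧[ M ] ↝ ⟦ K ⟧[ M' ]
  plug-preserves _↝_ compat k        r = r
  plug-preserves _↝_ compat (λb S K) r = plug-preserves _↝_ compat K (compat r)

  →aβ-leftApp : LeftAppCompatible _→aβ_
  →aβ-leftApp (inj₁ r) = inj₁ (ξ-app r)
  →aβ-leftApp (inj₂ r) = inj₂ (ξ-app r)

lemma4p11 : ∀ {c ℓ : Level} (R : Ring c ℓ) → let open Lang R in
    ∀ (K : Cont) (M M' : Term) → M →aβ M' → ⟦ K ⟧[ M ] →aβ ⟦ K ⟧[ M' ]
lemma4p11 R K M M' = plug-preserves R (Lang._→aβ_ R) (→aβ-leftApp R) K
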